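{- Let $\alpha,z$ be independent Haar-random elements of $\mathbf{Z}_2$ and $y$ an independent Haar-random element of $\mathbf{Z}_2^\times$, and let $k\ge0$ be an integer. Write $\Delta=\alpha^2+4yz$. Then: (1) $\Pr\big(v_2(\Delta)=k,\ \mathsf{sqf}(\Delta)\equiv1\pmod8,\ v_2(\alpha^2)<v_2(4yz)\big)$ is $0$ if $k$ is odd and $2^{ -(3k/2+2)}$ otherwise; (2) $\Pr\big(v_2(\Delta)=k,\ \mathsf{sqf}(\Delta)\equiv5\pmod8,\ v_2(\alpha^2)<v_2(4yz)\big)$ is $0$ if $k$ is odd and $2^{ -(3k/2+2)}$ otherwise; (3) $\Pr\big(v_2(\Delta)=k,\ \mathsf{sqf}(\Delta)\equiv3\pmod4,\ v_2(\alpha^2)<v_2(4yz)\big)$ is $0$ if $k$ is odd or $k=0$, and $2^{ -(3k/2+1)}$ otherwise; (4) $\Pr\big(v_2(\Delta)=k,\ \mathsf{sqf}(\Delta)\equiv2\pmod4,\ v_2(\alpha^2)<v_2(4yz)\big)=0$.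
   Context: For nonzero $\beta\in\mathbf{Z}_2$ write $\beta=2^{v}u$ with $v=v_2(\beta)$, $u\in\mathbf{Z}_2^\times$. The condition $\mathsf{sqf}(\beta)\equiv i\pmod 8$ for odd $i$ means $v$ even and $u\equiv i\pmod8$; $\mathsf{sqf}(\beta)\equiv3\pmod4$ means $v$ even and $u\equiv3\pmod4$; $\mathsf{sqf}(\beta)\equiv2\pmod4$ means $v$ odd. (Here $\mathsf{sqf}(\beta)=2^{v\bmod2}u$ is the squarefree part, defined up to unit squares.) Each probability is of the joint event (intersection of the listed conditions); $v_2(0)=\infty$. -}

module Defs where

open import Data.Nat using (ℕ; zero; suc; _+_; _*_; _∸_; _^_; _%_; _/_; _≡ᵇ_; _<ᵇ_)
open import Data.Nat.Properties using (m^n≢0)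
open import Data.Bool using (Bool; true; false; if_then_else_; _∧_)
open import Data.List using (List; upTo; map)
open import Data.Nat.ListAction using (sum)
open import Data.Integer using (+_)
open import Data.Rational as ℚ using (ℚ)

-- Haar measure on Z₂ × Z₂^× × Z₂ is computed at finite level N: a triple
-- (α, y, z) is represented by integer representatives a, y, z ∈ [0, 2^N)
-- (y odd), i.e. by its residue class mod 2^N, each class having
-- Haar measure 2^{-N} · 2^{-N} · 2^{-(N-1)} = 2^{-(3N-1)}.

-- Truncated 2-adic valuation at level N: val N x = min (v₂ x) N
-- (so val N x = N iff x ≡ 0 mod 2^N).
val : ℕ → ℕ → ℕ
val zero    x = zero
val (suc N) x = if x % 2 ≡ᵇ 0 then suc (val N (x / 2)) else zero

shr : ℕ → ℕ → ℕ
shr zero    x = x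
shr (suc v) x = shr v (x / 2)

-- Conditions on the squarefree part of β = 2^v u (v = v₂ β, u the unit part),
-- as in the paper's conventions; arguments: v and (a representative of) u.
SqfCond : Set
SqfCond = ℕ → ℕ → Bool

isEven : ℕ → Bool
isEven v = v % 2 ≡ᵇ 0

sqf≡1mod8 : SqfCond
sqf≡1mod8 v u = isEven v ∧ (u % 8 ≡ᵇ 1)

sqf≡5mod8 : SqfCond
sqf≡5mod8 v u = isEven v ∧ (u % 8 ≡ᵇ 5)

sqf≡3mod4 : SqfCond
sqf≡3mod4 v u = isEven v ∧ (u % 4 ≡ᵇ 3)

sqf≡2mod4 : SqfCond
sqf≡2mod4 v u = if isEven v then false else true

disc : ℕ → ℕ → ℕ → ℕ
disc a y z = a * a + 4 * y * z

-- The event  v₂(Δ) = k, sqf-condition on Δ, v₂(α²) < v₂(4yz),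
-- evaluated at level N (v₂(α²) = 2 v₂(α), v₂(4yz) = 2 + v₂(z) as y is a unit).
event : SqfCond → ℕ → ℕ → ℕ → ℕ → ℕ → Bool
event c N k a y z =
  (val N (disc a y z) ≡ᵇ k)
  ∧ c (val N (disc a y z)) (shr (val N (disc a y z)) (disc a y z))
  ∧ (2 * val N a <ᵇ 2 + val N z)

indicator : Bool → ℕ
indicator true  = 1
indicator false = 0

count : SqfCond → ℕ → ℕ → ℕ
count c N k =
  sum (map (λ a →
    sum (map (λ y →
      sum (map (λ z →
        indicator ((y % 2 ≡ᵇ 1) ∧ event c N k a y z))
        (upTo (2 ^ N))))
      (upTo (2 ^ N))))
    (upTo (2 ^ N)))

inv2^ : ℕ → ℚ
inv2^ e = ℚ._/_ (+ 1) (2 ^ e) {{m^n≢0 2 e}}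

Pr : SqfCond → ℕ → ℕ → ℚ
Pr c N k = ℚ._/_ (+ count c N k) (2 ^ (3 * N ∸ 1)) {{m^n≢0 2 (3 * N ∸ 1)}}

module Submission where

-- Write α = 2^m α′ and z = 2^w z′ with α′, z′ odd. The condition v₂(α²) < v₂(4yz) reads
-- w + 1 = 2m + e with e ≥ 0, and then Δ = 2^(2m) (α′² + 2^(e+1) y z′) with an odd bracket.
-- So v₂(Δ) = 2m is even, and since odd squares are 1 mod 8 the bracket is 3 or 7, 5, or 1 mod 8
-- according as e = 0, 1 or ≥ 2. For k = 2j each event is thus a product
-- {v₂(α) = j} × Z₂^× × {v₂(z) ∈ W} with W = {w > 2j}, {2j}, {2j − 1} for sqf ≡ 1 mod 8, 5 mod 8,
-- 3 mod 4, of measure 2^-(j+1) · 2^-(2j+1), 2^-(j+1) · 2^-(2j+1) and 2^-(j+1) · 2^-2j; odd k,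
-- sqf ≡ 2 mod 4, and sqf ≡ 3 mod 4 with j = 0 never occur. At level N ≥ k + 3 these sets are
-- unions of residue classes mod 2^N, so the measures are exact counts of residues.

open import Defs
open import Data.Nat using (ℕ; zero; suc; pred; _+_; _*_; _∸_; _^_; _%_; _/_; _≡ᵇ_; _<ᵇ_; _≤ᵇ_; _≤_; _<_; z≤n; s≤s; z<s; NonZero)
open import Data.Nat.Properties
open import Data.Nat.DivMod using (m%n%n≡m%n; m*n%n≡0; m*n/n≡m; [m+kn]%n≡m%n; m≡m%n+[m/n]*n; m%n<n; m∣n⇒o%n%m≡o%m; %-distribˡ-+; %-distribˡ-*)
open import Data.Nat.Divisibility using (divides)
open import Data.Nat.ListAction using (sum)
import Data.Integer as ℤ
open import Data.Integer.Properties using (pos-*)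
open import Data.Rational as ℚ using (0ℚ)
open import Data.Rational.Properties using (/-cong; 0/n≡0; fromℚᵘ-cong)
open import Data.Rational.Unnormalised using (mkℚᵘ; *≡*)
open import Data.List using (map; upTo; applyUpTo; _∷_; [])
open import Data.Bool using (Bool; true; false; _∧_; T)
open import Data.Bool.Properties using (∧-identityʳ; ∧-zeroʳ)
open import Data.Product using (∃; _×_; _,_; proj₂)
open import Data.Sum using (_⊎_; inj₁; inj₂)
open import Function using (_∘_; id)
open import Relation.Nullary using (¬_; Dec; yes; no)
open import Relation.Nullary.Decidable using (dec-true; dec-false)
open import Relation.Binary.PropositionalEquality
open import Data.Nat.Tactic.RingSolver using (solve-∀; solve)
open import Algebra.Properties.CommutativeSemigroup +-commutativeSemigroup using (interchange)

sumBelow : ℕ → (ℕ → ℕ) → ℕ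
sumBelow zero    f = 0
sumBelow (suc n) f = sumBelow n f + f n

sumBelow-suc : ∀ n f → sumBelow (suc n) f ≡ f 0 + sumBelow n (f ∘ suc)
sumBelow-suc zero    f = +-comm 0 (f 0)
sumBelow-suc (suc n) f = begin
  sumBelow (suc n) f + f (suc n)          ≡⟨ cong (_+ f (suc n)) (sumBelow-suc n f) ⟩
  f 0 + sumBelow n (f ∘ suc) + f (suc n)  ≡⟨ +-assoc (f 0) _ (f (suc n)) ⟩
  f 0 + sumBelow (suc n) (f ∘ suc)        ∎
  where open ≡-Reasoning

sum-map-applyUpTo : ∀ (f g : ℕ → ℕ) n → sum (map f (applyUpTo g n)) ≡ sumBelow n (f ∘ g)
sum-map-applyUpTo f g zero    = refl
sum-map-applyUpTo f g (suc n) =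
  trans (cong (f (g 0) +_) (sum-map-applyUpTo f (g ∘ suc) n)) (sym (sumBelow-suc n (f ∘ g)))

sum-map-upTo : ∀ f n → sum (map f (upTo n)) ≡ sumBelow n f
sum-map-upTo f = sum-map-applyUpTo f id

sumBelow-cong : ∀ n {f g} → (∀ x → f x ≡ g x) → sumBelow n f ≡ sumBelow n g
sumBelow-cong zero    f≗g = refl
sumBelow-cong (suc n) f≗g = cong₂ _+_ (sumBelow-cong n f≗g) (f≗g n)

sumBelow-const : ∀ n c → sumBelow n (λ _ → c) ≡ n * c
sumBelow-const zero    c = refl
sumBelow-const (suc n) c = trans (cong (_+ c) (sumBelow-const n c)) (+-comm (n * c) c)

sumBelow-*ˡ : ∀ n c f → sumBelow n (λ x → c * f x) ≡ c * sumBelow n f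
sumBelow-*ˡ zero    c f = sym (*-zeroʳ c)
sumBelow-*ˡ (suc n) c f =
  trans (cong (_+ c * f n) (sumBelow-*ˡ n c f)) (sym (*-distribˡ-+ c (sumBelow n f) (f n)))

sumBelow-*ʳ : ∀ n c f → sumBelow n (λ x → f x * c) ≡ sumBelow n f * c
sumBelow-*ʳ zero    c f = refl
sumBelow-*ʳ (suc n) c f =
  trans (cong (_+ f n * c) (sumBelow-*ʳ n c f)) (sym (*-distribʳ-+ c (sumBelow n f) (f n)))

sumBelow-double : ∀ n f → sumBelow (2 * n) f ≡ sumBelow n (λ t → f (2 * t)) + sumBelow n (λ t → f (suc (2 * t)))
sumBelow-double zero    f = refl
sumBelow-double (suc n) f = begin
  sumBelow (2 * suc n) f                                 ≡⟨ cong (λ m → sumBelow m f) (*-suc 2 n) ⟩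
  sumBelow (2 * n) f + f (2 * n) + f (suc (2 * n))       ≡⟨ cong (λ s → s + f (2 * n) + f (suc (2 * n))) (sumBelow-double n f) ⟩
  E + O + f (2 * n) + f (suc (2 * n))                    ≡⟨ +-assoc (E + O) _ _ ⟩
  (E + O) + (f (2 * n) + f (suc (2 * n)))                ≡⟨ interchange E O _ _ ⟩
  (E + f (2 * n)) + (O + f (suc (2 * n)))                ∎
  where
  open ≡-Reasoning
  E O : ℕ
  E = sumBelow n (λ t → f (2 * t))
  O = sumBelow n (λ t → f (suc (2 * t)))

sumBelow-separable : ∀ n f g h →
  sumBelow n (λ a → sumBelow n (λ y → sumBelow n (λ z → f a * (g y * h z)))) ≡ sumBelow n f * (sumBelow n g * sumBelow n h)
sumBelow-separable n f g h = begin
  sumBelow n (λ a → sumBelow n (λ y → sumBelow n (λ z → f a * (g y * h z))))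
    ≡⟨ sumBelow-cong n (λ a → sumBelow-cong n (λ y → trans (sumBelow-*ˡ n (f a) _) (cong (f a *_) (sumBelow-*ˡ n (g y) h)))) ⟩
  sumBelow n (λ a → sumBelow n (λ y → f a * (g y * H)))
    ≡⟨ sumBelow-cong n (λ a → trans (sumBelow-*ˡ n (f a) _) (cong (f a *_) (sumBelow-*ʳ n H g))) ⟩
  sumBelow n (λ a → f a * (G * H))
    ≡⟨ sumBelow-*ʳ n (G * H) f ⟩
  sumBelow n f * (G * H) ∎
  where
  open ≡-Reasoning
  G = sumBelow n g
  H = sumBelow n h

-- The truncated 2-adic valuation

2*n%2≡0 : ∀ n → 2 * n % 2 ≡ 0
2*n%2≡0 n = trans (cong (_% 2) (*-comm 2 n)) (m*n%n≡0 n 2)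

2*n/2≡n : ∀ n → 2 * n / 2 ≡ n
2*n/2≡n n = trans (cong (_/ 2) (*-comm 2 n)) (m*n/n≡m n 2)

[1+2*n]%2≡1 : ∀ n → suc (2 * n) % 2 ≡ 1
[1+2*n]%2≡1 n = trans (cong (λ m → suc m % 2) (*-comm 2 n)) ([m+kn]%n≡m%n 1 n 2)

n%2≡0⊎n%2≡1 : ∀ n → n % 2 ≡ 0 ⊎ n % 2 ≡ 1
n%2≡0⊎n%2≡1 n with n % 2 | m%n<n n 2
... | 0 | _ = inj₁ refl
... | 1 | _ = inj₂ refl
... | suc (suc _) | s≤s (s≤s ())

2^[1+i]*n≡2*[2^i*n] : ∀ i n → 2 ^ suc i * n ≡ 2 * (2 ^ i * n)
2^[1+i]*n≡2*[2^i*n] i n = *-assoc 2 (2 ^ i) n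

val-even : ∀ N n → n % 2 ≡ 0 → val (suc N) n ≡ suc (val N (n / 2))
val-even N n n%2≡0 rewrite n%2≡0 = refl

val-odd : ∀ N n → n % 2 ≡ 1 → val (suc N) n ≡ 0
val-odd N n n%2≡1 rewrite n%2≡1 = refl

val-double : ∀ N n → val (suc N) (2 * n) ≡ suc (val N n)
val-double N n = trans (val-even N (2 * n) (2*n%2≡0 n)) (cong (suc ∘ val N) (2*n/2≡n n))

val-decomposition : ∀ N n → ∃ λ u → n ≡ 2 ^ val N n * u × (val N n < N → u % 2 ≡ 1)
val-decomposition zero    n = n , sym (*-identityˡ n) , λ ()
val-decomposition (suc N) n with n%2≡0⊎n%2≡1 n
... | inj₂ n%2≡1 rewrite val-odd N n n%2≡1 = n , sym (*-identityˡ n) , λ _ → n%2≡1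
... | inj₁ n%2≡0 with val-decomposition N (n / 2)
...   | u , n/2≡2^v*u , u-odd rewrite val-even N n n%2≡0 = u , n≡2^[1+v]*u , u-odd ∘ ≤-pred
  where
  open ≡-Reasoning
  n≡2^[1+v]*u : n ≡ 2 ^ suc (val N (n / 2)) * u
  n≡2^[1+v]*u = begin
    n                           ≡⟨ m≡m%n+[m/n]*n n 2 ⟩
    n % 2 + n / 2 * 2           ≡⟨ cong (λ r → r + n / 2 * 2) n%2≡0 ⟩
    n / 2 * 2                   ≡⟨ *-comm (n / 2) 2 ⟩
    2 * (n / 2)                 ≡⟨ cong (2 *_) n/2≡2^v*u ⟩
    2 * (2 ^ val N (n / 2) * u) ≡⟨ 2^[1+i]*n≡2*[2^i*n] (val N (n / 2)) u ⟨
    2 ^ suc (val N (n / 2)) * u ∎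

val-2^i*odd : ∀ {N} i u → i < N → u % 2 ≡ 1 → val N (2 ^ i * u) ≡ i
val-2^i*odd {suc N} zero    u _         u%2≡1 = trans (cong (val (suc N)) (*-identityˡ u)) (val-odd N u u%2≡1)
val-2^i*odd {suc N} (suc i) u (s≤s i<N) u%2≡1 = begin
  val (suc N) (2 ^ suc i * u)   ≡⟨ cong (val (suc N)) (2^[1+i]*n≡2*[2^i*n] i u) ⟩
  val (suc N) (2 * (2 ^ i * u)) ≡⟨ val-double N (2 ^ i * u) ⟩
  suc (val N (2 ^ i * u))       ≡⟨ cong suc (val-2^i*odd i u i<N u%2≡1) ⟩
  suc i                         ∎
  where open ≡-Reasoning

val-2^i* : ∀ {N} i n → N ≤ i → val N (2 ^ i * n) ≡ N
val-2^i* {zero}  i       n _         = refl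
val-2^i* {suc N} (suc i) n (s≤s N≤i) = begin
  val (suc N) (2 ^ suc i * n)   ≡⟨ cong (val (suc N)) (2^[1+i]*n≡2*[2^i*n] i n) ⟩
  val (suc N) (2 * (2 ^ i * n)) ≡⟨ val-double N (2 ^ i * n) ⟩
  suc (val N (2 ^ i * n))       ≡⟨ cong suc (val-2^i* i n N≤i) ⟩
  suc N                         ∎
  where open ≡-Reasoning

shr-2^i* : ∀ i n → shr i (2 ^ i * n) ≡ n
shr-2^i* zero    n = *-identityˡ n
shr-2^i* (suc i) n = begin
  shr i (2 ^ suc i * n / 2)     ≡⟨ cong (λ m → shr i (m / 2)) (2^[1+i]*n≡2*[2^i*n] i n) ⟩
  shr i (2 * (2 ^ i * n) / 2)   ≡⟨ cong (shr i) (2*n/2≡n (2 ^ i * n)) ⟩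
  shr i (2 ^ i * n)             ≡⟨ shr-2^i* i n ⟩
  n                             ∎
  where open ≡-Reasoning

sumBelow-∘val : ∀ N (g : ℕ → ℕ) →
  sumBelow (2 ^ suc N) (g ∘ val (suc N)) ≡ sumBelow (2 ^ N) (g ∘ suc ∘ val N) + 2 ^ N * g 0
sumBelow-∘val N g = begin
  sumBelow (2 ^ suc N) (g ∘ val (suc N))                          ≡⟨ sumBelow-double (2 ^ N) (g ∘ val (suc N)) ⟩
  sumBelow (2 ^ N) (λ t → g (val (suc N) (2 * t)))
    + sumBelow (2 ^ N) (λ t → g (val (suc N) (suc (2 * t))))      ≡⟨ cong₂ _+_ (sumBelow-cong (2 ^ N) (cong g ∘ val-double N))
                                                                        (sumBelow-cong (2 ^ N) (λ t → cong g (val-odd N (suc (2 * t)) ([1+2*n]%2≡1 t)))) ⟩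
  sumBelow (2 ^ N) (g ∘ suc ∘ val N) + sumBelow (2 ^ N) (λ _ → g 0) ≡⟨ cong (sumBelow (2 ^ N) (g ∘ suc ∘ val N) +_) (sumBelow-const (2 ^ N) (g 0)) ⟩
  sumBelow (2 ^ N) (g ∘ suc ∘ val N) + 2 ^ N * g 0                ∎
  where open ≡-Reasoning

count-val≡ : ∀ {N} j r → j + suc r ≡ N → sumBelow (2 ^ N) (λ n → indicator (val N n ≡ᵇ j)) ≡ 2 ^ r
count-val≡ zero r refl = begin
  sumBelow (2 ^ suc r) (λ n → indicator (val (suc r) n ≡ᵇ 0))  ≡⟨ sumBelow-∘val r (λ v → indicator (v ≡ᵇ 0)) ⟩
  sumBelow (2 ^ r) (λ _ → 0) + 2 ^ r * 1                       ≡⟨ cong₂ _+_ (sumBelow-const (2 ^ r) 0) (*-identityʳ (2 ^ r)) ⟩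
  2 ^ r * 0 + 2 ^ r                                            ≡⟨ cong (_+ 2 ^ r) (*-zeroʳ (2 ^ r)) ⟩
  2 ^ r                                                        ∎
  where open ≡-Reasoning
count-val≡ (suc j) r refl = begin
  sumBelow (2 ^ suc N) (λ n → indicator (val (suc N) n ≡ᵇ suc j))  ≡⟨ sumBelow-∘val N (λ v → indicator (v ≡ᵇ suc j)) ⟩
  sumBelow (2 ^ N) (λ n → indicator (val N n ≡ᵇ j)) + 2 ^ N * 0    ≡⟨ cong₂ _+_ (count-val≡ j r refl) (*-zeroʳ (2 ^ N)) ⟩
  2 ^ r + 0                                                        ≡⟨ +-identityʳ (2 ^ r) ⟩
  2 ^ r                                                            ∎
  where
  open ≡-Reasoning
  N = j + suc r

≤ᵇ-suc : ∀ i v → (suc i ≤ᵇ suc v) ≡ (i ≤ᵇ v)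
≤ᵇ-suc zero    v = refl
≤ᵇ-suc (suc i) v = refl

count-≤val : ∀ {N} i r → i + r ≡ N → sumBelow (2 ^ N) (λ n → indicator (i ≤ᵇ val N n)) ≡ 2 ^ r
count-≤val zero r refl = trans (sumBelow-const (2 ^ r) 1) (*-identityʳ (2 ^ r))
count-≤val (suc i) r refl = begin
  sumBelow (2 ^ suc N) (λ n → indicator (suc i ≤ᵇ val (suc N) n))  ≡⟨ sumBelow-∘val N (λ v → indicator (suc i ≤ᵇ v)) ⟩
  sumBelow (2 ^ N) (λ n → indicator (suc i ≤ᵇ suc (val N n))) + 2 ^ N * 0
                                                                   ≡⟨ cong₂ _+_ (sumBelow-cong (2 ^ N) (λ n → cong indicator (≤ᵇ-suc i (val N n))))
                                                                                (*-zeroʳ (2 ^ N)) ⟩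
  sumBelow (2 ^ N) (λ n → indicator (i ≤ᵇ val N n)) + 0            ≡⟨ cong (_+ 0) (count-≤val i r refl) ⟩
  2 ^ r + 0                                                        ≡⟨ +-identityʳ (2 ^ r) ⟩
  2 ^ r                                                            ∎
  where
  open ≡-Reasoning
  N = i + r

count-odd : ∀ {N} r → suc r ≡ N → sumBelow (2 ^ N) (λ n → indicator (n % 2 ≡ᵇ 1)) ≡ 2 ^ r
count-odd r refl = begin
  sumBelow (2 ^ suc r) (λ n → indicator (n % 2 ≡ᵇ 1))              ≡⟨ sumBelow-double (2 ^ r) (λ n → indicator (n % 2 ≡ᵇ 1)) ⟩
  sumBelow (2 ^ r) (λ t → indicator (2 * t % 2 ≡ᵇ 1))
    + sumBelow (2 ^ r) (λ t → indicator (suc (2 * t) % 2 ≡ᵇ 1))    ≡⟨ cong₂ _+_ (sumBelow-cong (2 ^ r) (λ t → cong (λ b → indicator (b ≡ᵇ 1)) (2*n%2≡0 t)))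
                                                                                (sumBelow-cong (2 ^ r) (λ t → cong (λ b → indicator (b ≡ᵇ 1)) ([1+2*n]%2≡1 t))) ⟩
  sumBelow (2 ^ r) (λ _ → 0) + sumBelow (2 ^ r) (λ _ → 1)          ≡⟨ cong₂ _+_ (sumBelow-const (2 ^ r) 0) (sumBelow-const (2 ^ r) 1) ⟩
  2 ^ r * 0 + 2 ^ r * 1                                            ≡⟨ cong₂ _+_ (*-zeroʳ (2 ^ r)) (*-identityʳ (2 ^ r)) ⟩
  2 ^ r                                                            ∎
  where open ≡-Reasoning

-- Residues modulo 8

data OddBelow8 : ℕ → Set where
  one   : OddBelow8 1
  three : OddBelow8 3
  five  : OddBelow8 5
  seven : OddBelow8 7

odd%8 : ∀ n → n % 2 ≡ 1 → OddBelow8 (n % 8)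
odd%8 n n%2≡1 = residue (n % 8) (m%n<n n 8) (trans (m∣n⇒o%n%m≡o%m 2 8 n (divides 4 refl)) n%2≡1)
  where
  residue : ∀ r → r < 8 → r % 2 ≡ 1 → OddBelow8 r
  residue 1 _ _ = one
  residue 3 _ _ = three
  residue 5 _ _ = five
  residue 7 _ _ = seven
  residue 0 _ ()
  residue 2 _ ()
  residue 4 _ ()
  residue 6 _ ()
  residue (suc (suc (suc (suc (suc (suc (suc (suc _)))))))) (s≤s (s≤s (s≤s (s≤s (s≤s (s≤s (s≤s (s≤s ())))))))) _

odd²%8≡1 : ∀ a → a % 2 ≡ 1 → a * a % 8 ≡ 1
odd²%8≡1 a a%2≡1 = trans (%-distribˡ-* a a 8) (square (odd%8 a a%2≡1))
  where
  square : ∀ {r} → OddBelow8 r → r * r % 8 ≡ 1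
  square one   = refl
  square three = refl
  square five  = refl
  square seven = refl

[1+m*n]%8 : ∀ m n → (1 + m * n) % 8 ≡ (1 + m % 8 * (n % 8) % 8) % 8
[1+m*n]%8 m n = trans (%-distribˡ-+ 1 (m * n) 8) (cong (λ r → (1 + r) % 8) (%-distribˡ-* m n 8))

[odd²+n]%8 : ∀ a n → a % 2 ≡ 1 → (a * a + n) % 8 ≡ (1 + n) % 8
[odd²+n]%8 a n a%2≡1 = begin
  (a * a + n) % 8             ≡⟨ %-distribˡ-+ (a * a) n 8 ⟩
  (a * a % 8 + n % 8) % 8     ≡⟨ cong (λ r → (r + n % 8) % 8) (odd²%8≡1 a a%2≡1) ⟩
  (1 + n % 8) % 8             ≡⟨ %-distribˡ-+ 1 n 8 ⟨
  (1 + n) % 8                 ∎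
  where open ≡-Reasoning

[1+2*odd]%8 : ∀ t → t % 2 ≡ 1 → (1 + 2 * t) % 8 ≡ 3 ⊎ (1 + 2 * t) % 8 ≡ 7
[1+2*odd]%8 t t%2≡1 rewrite [1+m*n]%8 2 t = residue (odd%8 t t%2≡1)
  where
  residue : ∀ {r} → OddBelow8 r → (1 + 2 * r % 8) % 8 ≡ 3 ⊎ (1 + 2 * r % 8) % 8 ≡ 7
  residue one   = inj₁ refl
  residue three = inj₂ refl
  residue five  = inj₁ refl
  residue seven = inj₂ refl

[1+4*odd]%8≡5 : ∀ t → t % 2 ≡ 1 → (1 + 4 * t) % 8 ≡ 5
[1+4*odd]%8≡5 t t%2≡1 rewrite [1+m*n]%8 4 t = residue (odd%8 t t%2≡1)
  where
  residue : ∀ {r} → OddBelow8 r → (1 + 4 * r % 8) % 8 ≡ 5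
  residue one   = refl
  residue three = refl
  residue five  = refl
  residue seven = refl

[1+2^[3+e]*n]%8≡1 : ∀ e n → (1 + 2 ^ (3 + e) * n) % 8 ≡ 1
[1+2^[3+e]*n]%8≡1 e n = begin
  (1 + 2 ^ (3 + e) * n) % 8   ≡⟨ cong (λ m → (1 + m) % 8) 2^[3+e]*n≡2^e*n*8 ⟩
  (1 + 2 ^ e * n * 8) % 8     ≡⟨ [m+kn]%n≡m%n 1 (2 ^ e * n) 8 ⟩
  1                           ∎
  where
  open ≡-Reasoning
  2^[3+e]*n≡2^e*n*8 : 2 ^ (3 + e) * n ≡ 2 ^ e * n * 8
  2^[3+e]*n≡2^e*n*8 = begin
    2 ^ (3 + e) * n   ≡⟨ cong (_* n) (^-distribˡ-+-* 2 3 e) ⟩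
    8 * 2 ^ e * n     ≡⟨ *-assoc 8 (2 ^ e) n ⟩
    8 * (2 ^ e * n)   ≡⟨ *-comm 8 (2 ^ e * n) ⟩
    2 ^ e * n * 8     ∎

[odd²+2^[1+e]*n]%2≡1 : ∀ a e n → a % 2 ≡ 1 → (a * a + 2 ^ suc e * n) % 2 ≡ 1
[odd²+2^[1+e]*n]%2≡1 a e n a%2≡1 = begin
  (a * a + 2 ^ suc e * n) % 2   ≡⟨ cong (λ x → (a * a + x) % 2) (trans (*-assoc 2 (2 ^ e) n) (*-comm 2 (2 ^ e * n))) ⟩
  (a * a + 2 ^ e * n * 2) % 2   ≡⟨ [m+kn]%n≡m%n (a * a) (2 ^ e * n) 2 ⟩
  a * a % 2                     ≡⟨ %-distribˡ-* a a 2 ⟩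
  a % 2 * (a % 2) % 2           ≡⟨ cong (λ r → r * r % 2) a%2≡1 ⟩
  1                             ∎
  where open ≡-Reasoning

odd*odd%2≡1 : ∀ m n → m % 2 ≡ 1 → n % 2 ≡ 1 → m * n % 2 ≡ 1
odd*odd%2≡1 m n m%2≡1 n%2≡1 = trans (%-distribˡ-* m n 2) (cong₂ (λ r s → r * s % 2) m%2≡1 n%2≡1)

-- The residue mod 8 of a² + 2^(e+1) t for odd a and t; for e = 0 it is 3 or 7, which the
-- conditions below do not distinguish, and 3 stands for both.
offsetResidue : ℕ → ℕ
offsetResidue 0             = 3
offsetResidue 1             = 5
offsetResidue (suc (suc _)) = 1

record Mod8Determined (c : SqfCond) : Set where
  field
    at-even : ∀ j u → c (2 * j) u ≡ c 0 (u % 8)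
    7≈3     : c 0 7 ≡ c 0 3

isEven-2* : ∀ j → isEven (2 * j) ≡ true
isEven-2* j = cong (_≡ᵇ 0) (2*n%2≡0 j)

sqf≡1mod8-determined : Mod8Determined sqf≡1mod8
sqf≡1mod8-determined = record
  { at-even = λ j u → cong₂ _∧_ (isEven-2* j) (cong (_≡ᵇ 1) (sym (m%n%n≡m%n u 8)))
  ; 7≈3     = refl
  }

sqf≡5mod8-determined : Mod8Determined sqf≡5mod8
sqf≡5mod8-determined = record
  { at-even = λ j u → cong₂ _∧_ (isEven-2* j) (cong (_≡ᵇ 5) (sym (m%n%n≡m%n u 8)))
  ; 7≈3     = refl
  }

sqf≡3mod4-determined : Mod8Determined sqf≡3mod4
sqf≡3mod4-determined = record
  { at-even = λ j u → cong₂ _∧_ (isEven-2* j) (cong (_≡ᵇ 3) (sym (m∣n⇒o%n%m≡o%m 4 8 u (divides 2 refl))))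
  ; 7≈3     = refl
  }

unit-condition : ∀ {c} → Mod8Determined c →
  ∀ j e a t → a % 2 ≡ 1 → (e < 2 → t % 2 ≡ 1) →
  c (2 * j) (a * a + 2 ^ suc e * t) ≡ c 0 (offsetResidue e)
unit-condition {c} det j e a t a-odd t-odd = begin
  c (2 * j) (a * a + 2 ^ suc e * t)   ≡⟨ at-even j _ ⟩
  c 0 ((a * a + 2 ^ suc e * t) % 8)   ≡⟨ cong (c 0) ([odd²+n]%8 a _ a-odd) ⟩
  c 0 ((1 + 2 ^ suc e * t) % 8)       ≡⟨ residue e t-odd ⟩
  c 0 (offsetResidue e)               ∎
  where
  open ≡-Reasoning
  open Mod8Determined det
  residue : ∀ e → (e < 2 → t % 2 ≡ 1) → c 0 ((1 + 2 ^ suc e * t) % 8) ≡ c 0 (offsetResidue e)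
  residue 0 t-odd with [1+2*odd]%8 t (t-odd (s≤s z≤n))
  ... | inj₁ ≡3 = cong (c 0) ≡3
  ... | inj₂ ≡7 = trans (cong (c 0) ≡7) 7≈3
  residue 1 t-odd = cong (c 0) ([1+4*odd]%8≡5 t (t-odd (s≤s (s≤s z≤n))))
  residue (suc (suc e)) _ = cong (c 0) ([1+2^[3+e]*n]%8≡1 e t)

2^[2*m]≡2^m*2^m : ∀ m → 2 ^ (2 * m) ≡ 2 ^ m * 2 ^ m
2^[2*m]≡2^m*2^m m = trans (cong (λ n → 2 ^ (m + n)) (+-identityʳ m)) (^-distribˡ-+-* 2 m m)

disc-factor : ∀ m w e a y z → 2 + w ≡ 2 * m + suc e →
  disc (2 ^ m * a) y (2 ^ w * z) ≡ 2 ^ (2 * m) * (a * a + 2 ^ suc e * (y * z))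
disc-factor m w e a y z offset = begin
  (P * a) * (P * a) + 4 * y * (2 ^ w * z)   ≡⟨ regroup P a y (2 ^ w) z ⟩
  P * P * (a * a) + (4 * 2 ^ w) * (y * z)   ≡⟨ cong (λ n → P * P * (a * a) + n * (y * z)) 4*2^w≡P*P*R ⟩
  P * P * (a * a) + (P * P * R) * (y * z)   ≡⟨ factor (P * P) (a * a) R (y * z) ⟩
  P * P * (a * a + R * (y * z))             ≡⟨ cong (_* (a * a + R * (y * z))) (2^[2*m]≡2^m*2^m m) ⟨
  2 ^ (2 * m) * (a * a + R * (y * z))       ∎
  where
  open ≡-Reasoning
  P = 2 ^ m
  R = 2 ^ suc e
  regroup : ∀ P a y Q z → (P * a) * (P * a) + 4 * y * (Q * z) ≡ P * P * (a * a) + (4 * Q) * (y * z)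
  regroup = solve-∀
  factor : ∀ S A R T → S * A + (S * R) * T ≡ S * (A + R * T)
  factor = solve-∀
  4*2^w≡P*P*R : 4 * 2 ^ w ≡ P * P * R
  4*2^w≡P*P*R = begin
    4 * 2 ^ w                 ≡⟨ ^-distribˡ-+-* 2 2 w ⟨
    2 ^ (2 + w)               ≡⟨ cong (2 ^_) offset ⟩
    2 ^ (2 * m + suc e)       ≡⟨ ^-distribˡ-+-* 2 (2 * m) (suc e) ⟩
    2 ^ (2 * m) * R           ≡⟨ cong (_* R) (2^[2*m]≡2^m*2^m m) ⟩
    P * P * R                 ∎

-- If 2 v(α) ≥ N both sides are false: Δ vanishes mod 2^N, so its truncated valuation is N ≠ k.
event-unit : ∀ c {N k} a y z {a′ z′ e} → k < N →
  a ≡ 2 ^ val N a * a′ → (val N a < N → a′ % 2 ≡ 1) → z ≡ 2 ^ val N z * z′ →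
  2 + val N z ≡ 2 * val N a + suc e →
  event c N k a y z ≡ (2 * val N a ≡ᵇ k) ∧ c (2 * val N a) (a′ * a′ + 2 ^ suc e * (y * z′))
event-unit c {N} {k} a y z {a′} {z′} {e} k<N a≡2^m*a′ a′-odd z≡2^w*z′ offset = by-size (2 * m <? N)
  where
  open ≡-Reasoning
  m = val N a
  w = val N z
  u = a′ * a′ + 2 ^ suc e * (y * z′)
  Δ = disc a y z
  Δ≡2^[2m]*u : Δ ≡ 2 ^ (2 * m) * u
  Δ≡2^[2m]*u = trans (cong₂ (λ a z → disc a y z) a≡2^m*a′ z≡2^w*z′) (disc-factor m w e a′ y z′ offset)
  2m<2+w : 2 * m < 2 + w
  2m<2+w = subst (2 * m <_) (sym offset) (m<m+n (2 * m) z<s)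
  by-size : Dec (2 * m < N) → event c N k a y z ≡ (2 * m ≡ᵇ k) ∧ c (2 * m) u
  by-size (yes 2m<N) = begin
    (val N Δ ≡ᵇ k) ∧ c (val N Δ) (shr (val N Δ) Δ) ∧ (2 * m <ᵇ 2 + w) ≡⟨ cong₂ (λ v s → (v ≡ᵇ k) ∧ c v s ∧ (2 * m <ᵇ 2 + w)) val-Δ shr-Δ ⟩
    (2 * m ≡ᵇ k) ∧ c (2 * m) u ∧ (2 * m <ᵇ 2 + w)                     ≡⟨ cong (λ b → (2 * m ≡ᵇ k) ∧ c (2 * m) u ∧ b) (dec-true (2 * m <? 2 + w) 2m<2+w) ⟩
    (2 * m ≡ᵇ k) ∧ c (2 * m) u ∧ true                                 ≡⟨ cong ((2 * m ≡ᵇ k) ∧_) (∧-identityʳ (c (2 * m) u)) ⟩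
    (2 * m ≡ᵇ k) ∧ c (2 * m) u                                        ∎
    where
    u-odd : u % 2 ≡ 1
    u-odd = [odd²+2^[1+e]*n]%2≡1 a′ e (y * z′) (a′-odd (≤-<-trans (m≤m+n m (m + 0)) 2m<N))
    val-Δ : val N Δ ≡ 2 * m
    val-Δ = trans (cong (val N) Δ≡2^[2m]*u) (val-2^i*odd (2 * m) u 2m<N u-odd)
    shr-Δ : shr (val N Δ) Δ ≡ u
    shr-Δ = trans (cong₂ shr val-Δ Δ≡2^[2m]*u) (shr-2^i* (2 * m) u)
  by-size (no 2m≮N) = begin
    (val N Δ ≡ᵇ k) ∧ c (val N Δ) (shr (val N Δ) Δ) ∧ (2 * m <ᵇ 2 + w) ≡⟨ cong (λ v → (v ≡ᵇ k) ∧ c v (shr v Δ) ∧ (2 * m <ᵇ 2 + w)) val-Δ ⟩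
    (N ≡ᵇ k) ∧ c N (shr N Δ) ∧ (2 * m <ᵇ 2 + w)                       ≡⟨ cong (_∧ c N (shr N Δ) ∧ (2 * m <ᵇ 2 + w)) (dec-false (N ≟ k) (>⇒≢ k<N)) ⟩
    false                                                             ≡⟨ cong (_∧ c (2 * m) u) (dec-false (2 * m ≟ k) (>⇒≢ (<-≤-trans k<N N≤2m))) ⟨
    (2 * m ≡ᵇ k) ∧ c (2 * m) u                                        ∎
    where
    N≤2m : N ≤ 2 * m
    N≤2m = ≮⇒≥ 2m≮N
    val-Δ : val N Δ ≡ N
    val-Δ = trans (cong (val N) Δ≡2^[2m]*u) (val-2^i* (2 * m) u N≤2m)

2*m≡ᵇ2*n : ∀ m n → (2 * m ≡ᵇ 2 * n) ≡ (m ≡ᵇ n)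
2*m≡ᵇ2*n m n with m ≟ n
... | yes m≡n = trans (dec-true (2 * m ≟ 2 * n) (cong (2 *_) m≡n)) (sym (dec-true (m ≟ n) m≡n))
... | no  m≢n = trans (dec-false (2 * m ≟ 2 * n) (m≢n ∘ *-cancelˡ-≡ m n 2)) (sym (dec-false (m ≟ n) m≢n))

1+w≡n+e⇒w≤n : ∀ {w n e} → suc w ≡ n + e → e < 2 → w ≤ n
1+w≡n+e⇒w≤n {w} {n} {e} 1+w≡n+e (s≤s e≤1) =
  ≤-pred (subst (_≤ suc n) (sym 1+w≡n+e) (subst (n + e ≤_) (+-comm n 1) (+-monoʳ-≤ n e≤1)))

1+w≡n+0⇒w<n : ∀ {w n} → suc w ≡ n + 0 → w < n
1+w≡n+0⇒w<n {w} {n} eq = ≤-reflexive (trans eq (+-identityʳ n))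

1+w≡n+1⇒w≡n : ∀ {w n} → suc w ≡ n + 1 → w ≡ n
1+w≡n+1⇒w≡n {w} {n} eq = suc-injective (trans eq (+-comm n 1))

1+w≡n+2+e⇒n<w : ∀ {w n e} → suc w ≡ n + suc (suc e) → n < w
1+w≡n+2+e⇒n<w {w} {n} {e} eq = subst (n <_) (sym (suc-injective (trans eq (+-suc n (suc e))))) (m<m+n n z<s)

∧-cong-if : ∀ b {x y} → (T b → x ≡ y) → b ∧ x ≡ b ∧ y
∧-cong-if true  x≡y = x≡y _
∧-cong-if false _   = refl

event-below : ∀ c N k a y z → ¬ (2 * val N a < 2 + val N z) → event c N k a y z ≡ false
event-below c N k a y z 2m≮2+w = begin
  (val N Δ ≡ᵇ k) ∧ c (val N Δ) (shr (val N Δ) Δ) ∧ (2 * val N a <ᵇ 2 + val N z)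
    ≡⟨ cong (λ b → (val N Δ ≡ᵇ k) ∧ c (val N Δ) (shr (val N Δ) Δ) ∧ b) (dec-false (2 * val N a <? 2 + val N z) 2m≮2+w) ⟩
  (val N Δ ≡ᵇ k) ∧ c (val N Δ) (shr (val N Δ) Δ) ∧ false
    ≡⟨ cong ((val N Δ ≡ᵇ k) ∧_) (∧-zeroʳ _) ⟩
  (val N Δ ≡ᵇ k) ∧ false
    ≡⟨ ∧-zeroʳ _ ⟩
  false ∎
  where
  open ≡-Reasoning
  Δ = disc a y z

event-even-valuation : ∀ {c} → Mod8Determined c → ∀ {N} j (Z : ℕ → Bool) →
  (∀ w → 2 + w ≤ 2 * j → Z w ≡ false) →
  (∀ w e → suc w ≡ 2 * j + e → Z w ≡ c 0 (offsetResidue e)) →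
  2 * j < N → ∀ a y z → y % 2 ≡ 1 → event c N (2 * j) a y z ≡ (val N a ≡ᵇ j) ∧ Z (val N z)
event-even-valuation {c} det {N} j Z Z-below Z-offset 2j<N a y z y-odd
  with 2 * val N a <? 2 + val N z
... | no 2m≮2+w = begin
  event c N (2 * j) a y z     ≡⟨ event-below c N (2 * j) a y z 2m≮2+w ⟩
  false                       ≡⟨ ∧-zeroʳ (val N a ≡ᵇ j) ⟨
  (val N a ≡ᵇ j) ∧ false      ≡⟨ ∧-cong-if (val N a ≡ᵇ j) Z-below-at-j ⟨
  (val N a ≡ᵇ j) ∧ Z (val N z) ∎
  where
  open ≡-Reasoning
  Z-below-at-j : T (val N a ≡ᵇ j) → Z (val N z) ≡ false
  Z-below-at-j m≡ᵇj = Z-below (val N z) (subst (λ i → 2 + val N z ≤ 2 * i) (≡ᵇ⇒≡ (val N a) j m≡ᵇj) (≮⇒≥ 2m≮2+w))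
... | yes 2m<2+w with m≤n⇒∃[o]m+o≡n 2m<2+w | val-decomposition N a | val-decomposition N z
...   | e , 1+2m+e≡2+w | a′ , a≡2^m*a′ , a′-odd | z′ , z≡2^w*z′ , z′-odd = begin
  event c N (2 * j) a y z     ≡⟨ event-unit c a y z 2j<N a≡2^m*a′ a′-odd z≡2^w*z′ offset ⟩
  (2 * m ≡ᵇ 2 * j) ∧ c (2 * m) u
                              ≡⟨ cong (_∧ c (2 * m) u) (2*m≡ᵇ2*n m j) ⟩
  (m ≡ᵇ j) ∧ c (2 * m) u      ≡⟨ ∧-cong-if (m ≡ᵇ j) (unit-at-j ∘ ≡ᵇ⇒≡ m j) ⟩
  (m ≡ᵇ j) ∧ Z w              ∎
  where
  open ≡-Reasoning
  m = val N a
  w = val N z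
  u = a′ * a′ + 2 ^ suc e * (y * z′)
  offset : 2 + w ≡ 2 * m + suc e
  offset = trans (sym 1+2m+e≡2+w) (sym (+-suc (2 * m) e))
  1+w≡2m+e : suc w ≡ 2 * m + e
  1+w≡2m+e = suc-injective (sym 1+2m+e≡2+w)
  unit-at-j : m ≡ j → c (2 * m) u ≡ Z w
  unit-at-j m≡j = trans (unit-condition det m e a′ (y * z′) (a′-odd (≤-<-trans (m≤m+n m (m + 0)) 2m<N)) t-odd)
                        (sym (Z-offset w e (subst (λ i → suc w ≡ 2 * i + e) m≡j 1+w≡2m+e)))
    where
    2m<N : 2 * m < N
    2m<N = subst (λ i → 2 * i < N) (sym m≡j) 2j<N
    t-odd : e < 2 → y * z′ % 2 ≡ 1
    t-odd e<2 = odd*odd%2≡1 y z′ y-odd (z′-odd (≤-<-trans (1+w≡n+e⇒w≤n 1+w≡2m+e e<2) 2m<N))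

event-null : ∀ c {N k} → k < N → (∀ m u → (2 * m ≡ᵇ k) ∧ c (2 * m) u ≡ false) →
  ∀ a y z → event c N k a y z ≡ false
event-null c {N} {k} k<N never a y z with 2 * val N a <? 2 + val N z
... | no 2m≮2+w = event-below c N k a y z 2m≮2+w
... | yes 2m<2+w with m≤n⇒∃[o]m+o≡n 2m<2+w | val-decomposition N a | val-decomposition N z
...   | e , 1+2m+e≡2+w | a′ , a≡2^m*a′ , a′-odd | z′ , z≡2^w*z′ , _ =
  trans (event-unit c a y z k<N a≡2^m*a′ a′-odd z≡2^w*z′ (trans (sym 1+2m+e≡2+w) (sym (+-suc (2 * val N a) e))))
        (never (val N a) _)

indicator-∧ : ∀ b c → indicator (b ∧ c) ≡ indicator b * indicator c
indicator-∧ true  c = sym (+-identityʳ (indicator c))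
indicator-∧ false c = refl

count-factorises : ∀ c N k (A B : ℕ → Bool) →
  (∀ a y z → y % 2 ≡ 1 → event c N k a y z ≡ A (val N a) ∧ B (val N z)) →
  count c N k ≡ sumBelow (2 ^ N) (λ a → indicator (A (val N a)))
                * (sumBelow (2 ^ N) (λ y → indicator (y % 2 ≡ᵇ 1)) * sumBelow (2 ^ N) (λ z → indicator (B (val N z))))
count-factorises c N k A B factors = begin
  count c N k
    ≡⟨ trans (sum-map-upTo _ M) (sumBelow-cong M (λ a → trans (sum-map-upTo _ M) (sumBelow-cong M (λ y → sum-map-upTo _ M)))) ⟩
  sumBelow M (λ a → sumBelow M (λ y → sumBelow M (λ z → indicator ((y % 2 ≡ᵇ 1) ∧ event c N k a y z))))
    ≡⟨ sumBelow-cong M (λ a → sumBelow-cong M (λ y → sumBelow-cong M (λ z → pointwise a y z))) ⟩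
  sumBelow M (λ a → sumBelow M (λ y → sumBelow M (λ z →
    indicator (A (val N a)) * (indicator (y % 2 ≡ᵇ 1) * indicator (B (val N z))))))
    ≡⟨ sumBelow-separable M _ _ _ ⟩
  _ ∎
  where
  open ≡-Reasoning
  M = 2 ^ N
  pointwise : ∀ a y z → indicator ((y % 2 ≡ᵇ 1) ∧ event c N k a y z)
                        ≡ indicator (A (val N a)) * (indicator (y % 2 ≡ᵇ 1) * indicator (B (val N z)))
  pointwise a y z with y % 2 ≡ᵇ 1 in y-odd
  ... | false = sym (*-zeroʳ (indicator (A (val N a))))
  ... | true  = begin
    indicator (event c N k a y z)                            ≡⟨ cong indicator (factors a y z (≡ᵇ⇒≡ (y % 2) 1 (subst T (sym y-odd) _))) ⟩
    indicator (A (val N a) ∧ B (val N z))                    ≡⟨ indicator-∧ (A (val N a)) (B (val N z)) ⟩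
    indicator (A (val N a)) * indicator (B (val N z))        ≡⟨ cong (indicator (A (val N a)) *_) (+-identityʳ _) ⟨
    indicator (A (val N a)) * (1 * indicator (B (val N z)))  ∎

count-null : ∀ c N k → (∀ a y z → y % 2 ≡ 1 → event c N k a y z ≡ false) → count c N k ≡ 0
count-null c N k null =
  trans (count-factorises c N k (λ _ → false) (λ _ → false) null)
        (cong (_* R) (trans (sumBelow-const (2 ^ N) 0) (*-zeroʳ (2 ^ N))))
  where
  R : ℕ
  R = sumBelow (2 ^ N) (λ y → indicator (y % 2 ≡ᵇ 1)) * sumBelow (2 ^ N) (λ _ → 0)

+m/n≡+1/o : ∀ m n o .{{_ : NonZero n}} .{{_ : NonZero o}} → n ≡ m * o → ℤ.+ m ℚ./ n ≡ ℤ.+ 1 ℚ./ o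
+m/n≡+1/o m n o n≡m*o = begin
  ℤ.+ m ℚ./ n            ≡⟨ /-cong {ℤ.+ m} {n} refl (sym (suc-pred n)) ⟩
  ℤ.+ m ℚ./ suc (pred n) ≡⟨ fromℚᵘ-cong {mkℚᵘ (ℤ.+ m) (pred n)} {mkℚᵘ (ℤ.+ 1) (pred o)} (*≡* cross) ⟩
  ℤ.+ 1 ℚ./ suc (pred o) ≡⟨ /-cong {ℤ.+ 1} {suc (pred o)} refl (suc-pred o) ⟩
  ℤ.+ 1 ℚ./ o            ∎
  where
  open ≡-Reasoning
  cross : ℤ.+ m ℤ.* ℤ.+ suc (pred o) ≡ ℤ.+ 1 ℤ.* ℤ.+ suc (pred n)
  cross = begin
    ℤ.+ m ℤ.* ℤ.+ suc (pred o)   ≡⟨ pos-* m (suc (pred o)) ⟨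
    ℤ.+ (m * suc (pred o))       ≡⟨ cong (λ x → ℤ.+ (m * x)) (suc-pred o) ⟩
    ℤ.+ (m * o)                  ≡⟨ cong ℤ.+_ (trans (sym n≡m*o) (sym (suc-pred n))) ⟩
    ℤ.+ suc (pred n)             ≡⟨ cong ℤ.+_ (*-identityˡ (suc (pred n))) ⟨
    ℤ.+ (1 * suc (pred n))       ≡⟨ pos-* 1 (suc (pred n)) ⟩
    ℤ.+ 1 ℤ.* ℤ.+ suc (pred n)   ∎

Pr-null : ∀ c N k → count c N k ≡ 0 → Pr c N k ≡ 0ℚ
Pr-null c N k count≡0 =
  trans (/-cong {{m^n≢0 2 (3 * N ∸ 1)}} {{m^n≢0 2 (3 * N ∸ 1)}} (cong ℤ.+_ count≡0) refl) (0/n≡0 (2 ^ (3 * N ∸ 1)) {{m^n≢0 2 (3 * N ∸ 1)}})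

Pr-2^ : ∀ c N k s e → count c N k ≡ 2 ^ s → suc (s + e) ≡ 3 * N → Pr c N k ≡ inv2^ e
Pr-2^ c N k s e count≡2^s 1+s+e≡3N = +m/n≡+1/o (count c N k) (2 ^ (3 * N ∸ 1)) (2 ^ e) {{m^n≢0 2 (3 * N ∸ 1)}} {{m^n≢0 2 e}} (begin
  2 ^ (3 * N ∸ 1)          ≡⟨ cong (λ n → 2 ^ (n ∸ 1)) 1+s+e≡3N ⟨
  2 ^ (s + e)              ≡⟨ ^-distribˡ-+-* 2 s e ⟩
  2 ^ s * 2 ^ e            ≡⟨ cong (_* 2 ^ e) count≡2^s ⟨
  count c N k * 2 ^ e      ∎)
  where open ≡-Reasoning

Pr-factorised : ∀ c N k (A B : ℕ → Bool) p q r e →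
  (∀ a y z → y % 2 ≡ 1 → event c N k a y z ≡ A (val N a) ∧ B (val N z)) →
  sumBelow (2 ^ N) (λ a → indicator (A (val N a))) ≡ 2 ^ p →
  sumBelow (2 ^ N) (λ y → indicator (y % 2 ≡ᵇ 1)) ≡ 2 ^ q →
  sumBelow (2 ^ N) (λ z → indicator (B (val N z))) ≡ 2 ^ r →
  suc (p + (q + r) + e) ≡ 3 * N → Pr c N k ≡ inv2^ e
Pr-factorised c N k A B p q r e factors #A #odd #B 1+p+q+r+e≡3N = Pr-2^ c N k (p + (q + r)) e (begin
  count c N k              ≡⟨ trans (count-factorises c N k A B factors) (cong₂ _*_ #A (cong₂ _*_ #odd #B)) ⟩
  2 ^ p * (2 ^ q * 2 ^ r)  ≡⟨ cong (2 ^ p *_) (^-distribˡ-+-* 2 q r) ⟨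
  2 ^ p * 2 ^ (q + r)      ≡⟨ ^-distribˡ-+-* 2 p (q + r) ⟨
  2 ^ (p + (q + r))        ∎) 1+p+q+r+e≡3N
  where open ≡-Reasoning

Pr-odd-valuation : ∀ c {N} j → suc (2 * j) < N → Pr c N (suc (2 * j)) ≡ 0ℚ
Pr-odd-valuation c {N} j k<N = Pr-null c N _ (count-null c N _ (λ a y z _ → event-null c k<N never a y z))
  where
  never : ∀ m u → (2 * m ≡ᵇ suc (2 * j)) ∧ c (2 * m) u ≡ false
  never m u = cong (_∧ c (2 * m) u) (dec-false (2 * m ≟ suc (2 * j))
    (λ 2m≡1+2j → 0≢1+n (trans (sym (2*n%2≡0 m)) (trans (cong (_% 2) 2m≡1+2j) ([1+2*n]%2≡1 j)))))

Pr-2mod4 : ∀ {N k} → k < N → Pr sqf≡2mod4 N k ≡ 0ℚ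
Pr-2mod4 {N} {k} k<N = Pr-null sqf≡2mod4 N k (count-null sqf≡2mod4 N k (λ a y z _ → event-null sqf≡2mod4 k<N never a y z))
  where
  never : ∀ m u → (2 * m ≡ᵇ k) ∧ sqf≡2mod4 (2 * m) u ≡ false
  never m u rewrite isEven-2* m = ∧-zeroʳ (2 * m ≡ᵇ k)

-- The three conditions at even valuation

event-1mod8 : ∀ {N} j → 2 * j < N → ∀ a y z → y % 2 ≡ 1 →
  event sqf≡1mod8 N (2 * j) a y z ≡ (val N a ≡ᵇ j) ∧ (suc (2 * j) ≤ᵇ val N z)
event-1mod8 j = event-even-valuation sqf≡1mod8-determined j (suc (2 * j) ≤ᵇ_) below offset
  where
  below : ∀ w → 2 + w ≤ 2 * j → (suc (2 * j) ≤ᵇ w) ≡ false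
  below w 2+w≤2j = dec-false (suc (2 * j) ≤? w) λ 2j<w → <-asym 2j<w (<-trans (n<1+n w) 2+w≤2j)
  offset : ∀ w e → suc w ≡ 2 * j + e → (suc (2 * j) ≤ᵇ w) ≡ sqf≡1mod8 0 (offsetResidue e)
  offset w 0             eq = dec-false (suc (2 * j) ≤? w) (<-asym (1+w≡n+0⇒w<n eq))
  offset w 1             eq = dec-false (suc (2 * j) ≤? w) (<-irrefl (sym (1+w≡n+1⇒w≡n eq)))
  offset w (suc (suc e)) eq = dec-true (suc (2 * j) ≤? w) (1+w≡n+2+e⇒n<w eq)

event-5mod8 : ∀ {N} j → 2 * j < N → ∀ a y z → y % 2 ≡ 1 →
  event sqf≡5mod8 N (2 * j) a y z ≡ (val N a ≡ᵇ j) ∧ (val N z ≡ᵇ 2 * j)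
event-5mod8 j = event-even-valuation sqf≡5mod8-determined j (_≡ᵇ 2 * j) below offset
  where
  below : ∀ w → 2 + w ≤ 2 * j → (w ≡ᵇ 2 * j) ≡ false
  below w 2+w≤2j = dec-false (w ≟ 2 * j) (<⇒≢ (<-trans (n<1+n w) 2+w≤2j))
  offset : ∀ w e → suc w ≡ 2 * j + e → (w ≡ᵇ 2 * j) ≡ sqf≡5mod8 0 (offsetResidue e)
  offset w 0             eq = dec-false (w ≟ 2 * j) (<⇒≢ (1+w≡n+0⇒w<n eq))
  offset w 1             eq = dec-true (w ≟ 2 * j) (1+w≡n+1⇒w≡n eq)
  offset w (suc (suc e)) eq = dec-false (w ≟ 2 * j) (>⇒≢ (1+w≡n+2+e⇒n<w eq))

event-3mod4 : ∀ {N} j → 2 * j < N → ∀ a y z → y % 2 ≡ 1 →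
  event sqf≡3mod4 N (2 * j) a y z ≡ (val N a ≡ᵇ j) ∧ (suc (val N z) ≡ᵇ 2 * j)
event-3mod4 j = event-even-valuation sqf≡3mod4-determined j (λ w → suc w ≡ᵇ 2 * j) below offset
  where
  below : ∀ w → 2 + w ≤ 2 * j → (suc w ≡ᵇ 2 * j) ≡ false
  below w 2+w≤2j = dec-false (suc w ≟ 2 * j) (<⇒≢ 2+w≤2j)
  offset : ∀ w e → suc w ≡ 2 * j + e → (suc w ≡ᵇ 2 * j) ≡ sqf≡3mod4 0 (offsetResidue e)
  offset w 0             eq = dec-true (suc w ≟ 2 * j) (trans eq (+-identityʳ (2 * j)))
  offset w 1             eq = dec-false (suc w ≟ 2 * j) (>⇒≢ (≤-reflexive (cong suc (sym (1+w≡n+1⇒w≡n eq)))))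
  offset w (suc (suc e)) eq = dec-false (suc w ≟ 2 * j) (>⇒≢ (<-trans (1+w≡n+2+e⇒n<w eq) (n<1+n w)))

n<n+3+d : ∀ n d → n < n + 3 + d
n<n+3+d n d = ≤-trans (m<m+n n z<s) (m≤m+n (n + 3) d)

≥-by-offset : ∀ {n} (P : ℕ → Set) → (∀ d → P (n + d)) → ∀ {N} → n ≤ N → P N
≥-by-offset P p n≤N = subst P (proj₂ (m≤n⇒∃[o]m+o≡n n≤N)) (p _)

module _ (j : ℕ) where
  private
    #val≡j : ∀ d → sumBelow (2 ^ (2 * j + 3 + d)) (λ a → indicator (val (2 * j + 3 + d) a ≡ᵇ j)) ≡ 2 ^ (j + 2 + d)
    #val≡j d = count-val≡ j (j + 2 + d) level
      where
      level : j + suc (j + 2 + d) ≡ 2 * j + 3 + d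
      level = solve (j ∷ d ∷ [])
    #odd : ∀ d → sumBelow (2 ^ (2 * j + 3 + d)) (λ y → indicator (y % 2 ≡ᵇ 1)) ≡ 2 ^ (2 * j + 2 + d)
    #odd d = count-odd (2 * j + 2 + d) level
      where
      level : suc (2 * j + 2 + d) ≡ 2 * j + 3 + d
      level = solve (j ∷ d ∷ [])
    exponents : ∀ d → suc (j + 2 + d + (2 * j + 2 + d + (2 + d)) + (3 * j + 2)) ≡ 3 * (2 * j + 3 + d)
    exponents d = solve (j ∷ d ∷ [])

  Pr-1mod8 : ∀ {N} → 2 * j + 3 ≤ N → Pr sqf≡1mod8 N (2 * j) ≡ inv2^ (3 * j + 2)
  Pr-1mod8 = ≥-by-offset (λ N → Pr sqf≡1mod8 N (2 * j) ≡ inv2^ (3 * j + 2)) λ d →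
    Pr-factorised sqf≡1mod8 (2 * j + 3 + d) (2 * j) (_≡ᵇ j) (suc (2 * j) ≤ᵇ_)
      (j + 2 + d) (2 * j + 2 + d) (2 + d) (3 * j + 2)
      (event-1mod8 j (n<n+3+d (2 * j) d)) (#val≡j d) (#odd d) (count-≤val (suc (2 * j)) (2 + d) (level d)) (exponents d)
    where
    level : ∀ d → suc (2 * j) + (2 + d) ≡ 2 * j + 3 + d
    level d = solve (j ∷ d ∷ [])

  Pr-5mod8 : ∀ {N} → 2 * j + 3 ≤ N → Pr sqf≡5mod8 N (2 * j) ≡ inv2^ (3 * j + 2)
  Pr-5mod8 = ≥-by-offset (λ N → Pr sqf≡5mod8 N (2 * j) ≡ inv2^ (3 * j + 2)) λ d →
    Pr-factorised sqf≡5mod8 (2 * j + 3 + d) (2 * j) (_≡ᵇ j) (_≡ᵇ 2 * j)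
      (j + 2 + d) (2 * j + 2 + d) (2 + d) (3 * j + 2)
      (event-5mod8 j (n<n+3+d (2 * j) d)) (#val≡j d) (#odd d) (count-val≡ (2 * j) (2 + d) (level d)) (exponents d)
    where
    level : ∀ d → 2 * j + suc (2 + d) ≡ 2 * j + 3 + d
    level d = solve (j ∷ d ∷ [])

Pr-3mod4 : ∀ {N} i → 2 * suc i + 3 ≤ N → Pr sqf≡3mod4 N (2 * suc i) ≡ inv2^ (3 * suc i + 1)
Pr-3mod4 i = ≥-by-offset (λ N → Pr sqf≡3mod4 N (2 * suc i) ≡ inv2^ (3 * suc i + 1)) λ d →
  Pr-factorised sqf≡3mod4 (2 * suc i + 3 + d) (2 * suc i) (_≡ᵇ suc i) (λ w → suc w ≡ᵇ 2 * suc i)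
    (suc i + 2 + d) (2 * suc i + 2 + d) (3 + d) (3 * suc i + 1)
    (event-3mod4 (suc i) (n<n+3+d (2 * suc i) d))
    (count-val≡ (suc i) (suc i + 2 + d) (level-a d)) (count-odd (2 * suc i + 2 + d) (level-y d)) (#val≡2i+1 d) (exponents d)
  where
  level-a : ∀ d → suc i + suc (suc i + 2 + d) ≡ 2 * suc i + 3 + d
  level-a d = solve (i ∷ d ∷ [])
  level-y : ∀ d → suc (2 * suc i + 2 + d) ≡ 2 * suc i + 3 + d
  level-y d = solve (i ∷ d ∷ [])
  level-z : ∀ d → suc (2 * i) + suc (3 + d) ≡ 2 * suc i + 3 + d
  level-z d = solve (i ∷ d ∷ [])
  exponents : ∀ d → suc (suc i + 2 + d + (2 * suc i + 2 + d + (3 + d)) + (3 * suc i + 1)) ≡ 3 * (2 * suc i + 3 + d)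
  exponents d = solve (i ∷ d ∷ [])
  #val≡2i+1 : ∀ d → let N = 2 * suc i + 3 + d in
    sumBelow (2 ^ N) (λ z → indicator (suc (val N z) ≡ᵇ 2 * suc i)) ≡ 2 ^ (3 + d)
  #val≡2i+1 d = trans (sumBelow-cong (2 ^ N) (λ z → cong (λ n → indicator (suc (val N z) ≡ᵇ n)) (*-suc 2 i)))
                      (count-val≡ (suc (2 * i)) (3 + d) (level-z d))
    where
    N = 2 * suc i + 3 + d

Pr-3mod4-0 : ∀ {N} → 3 ≤ N → Pr sqf≡3mod4 N 0 ≡ 0ℚ
Pr-3mod4-0 {N} 3≤N = Pr-null sqf≡3mod4 N 0 (count-null sqf≡3mod4 N 0 λ a y z y-odd →
  trans (event-3mod4 {N} 0 (≤-trans (s≤s z≤n) 3≤N) a y z y-odd) (∧-zeroʳ (val N a ≡ᵇ 0)))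

lemma6p4 : (k N : ℕ) → k + 3 ≤ N →
    ((j : ℕ) → k ≡ 1 + 2 * j →
        (Pr sqf≡1mod8 N k ≡ 0ℚ) × (Pr sqf≡5mod8 N k ≡ 0ℚ)
      × (Pr sqf≡3mod4 N k ≡ 0ℚ) × (Pr sqf≡2mod4 N k ≡ 0ℚ))
    × ((j : ℕ) → k ≡ 2 * j →
        (Pr sqf≡1mod8 N k ≡ inv2^ (3 * j + 2)) × (Pr sqf≡5mod8 N k ≡ inv2^ (3 * j + 2))
      × (Pr sqf≡2mod4 N k ≡ 0ℚ))
    × (k ≡ 0 → Pr sqf≡3mod4 N k ≡ 0ℚ)
    × ((j : ℕ) → k ≡ 2 * suc j → Pr sqf≡3mod4 N k ≡ inv2^ (3 * suc j + 1))
lemma6p4 k N k+3≤N =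
    (λ { j refl → Pr-odd-valuation sqf≡1mod8 j k<N , Pr-odd-valuation sqf≡5mod8 j k<N
                , Pr-odd-valuation sqf≡3mod4 j k<N , Pr-2mod4 k<N })
  , (λ { j refl → Pr-1mod8 j k+3≤N , Pr-5mod8 j k+3≤N , Pr-2mod4 k<N })
  , (λ { refl → Pr-3mod4-0 k+3≤N })
  , (λ { j refl → Pr-3mod4 j k+3≤N })
  where
  k<N : k < N
  k<N = <-≤-trans (m<m+n k z<s) k+3≤N
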